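{- Let $G$ be an unweighted undirected $n$-vertex graph, $f\ge 1$ an integer and $p>0$ a parameter. Run the following algorithm. Initially every vertex is colored white and has $\mathrm{counter}(v)=f+1$; $S=\emptyset$, $E'=\emptyset$. While there exists a vertex $s\in V\setminus S$ having at least $p$ white neighbors: add $s$ to $S$ and color $s$ red; for each white neighbor $u$ of $s$, decrement $\mathrm{counter}(u)$, add the edge $(s,u)$ to $E'$, and if $\mathrm{counter}(u)=0$ color $u$ black. After the loop, add to $E'$ every edge of $G$ having at least one endpoint colored white. Finally let $A_S$ be a $\beta$-additive $f$-EFT (resp. $f$-VFT) sourcewise spanner of $G$ with respect to the source set $S$, and return $H=(V(G),E'\cup E(A_S))$. Then $H$ has $O\!\left(np+nf+\gamma\!\left(n,\left\lfloor \frac{(f+1)n}{p}\right\rfloor\right)\right)$ edges, where $\gamma(n,\ell)$ is the size of the spanner $A_S$ when $|S|=\ell$.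
   Context: $d_X(u,v)$ is the shortest-path distance in graph $X$; $X-F$ denotes removal of a set $F$ of edges (resp. vertices with their incident edges). A subgraph $A_S$ of $G$ is a $\beta$-additive $f$-EFT (resp. $f$-VFT) sourcewise spanner w.r.t. $S\subseteq V(G)$ if for every set $F$ of at most $f$ edges (resp. vertices), $d_{A_S-F}(s,t)\le d_{G-F}(s,t)+\beta$ for all $s\in S$, $t\in V(G)$. The function $\gamma(n,\ell)$ is understood as a bound on the size of the sourcewise spanner used, as a function of the number $\ell$ of sources (nondecreasing in $\ell$).
   Formalization: The parameter p ranges over the positive rationals. -}

module Defs where

open import Data.Bool using (Bool; true; false; _∧_; _∨_; not; if_then_else_)
open import Data.Nat using (ℕ; zero; suc; _+_; _*_; _∸_; _≤_; _<ᵇ_; _≡ᵇ_)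
open import Data.Fin using (Fin; toℕ) renaming (zero to fzero; suc to fsuc)
open import Data.Fin.Properties using () renaming (_≟_ to _≟ᶠ_)
open import Data.List using (List; length)
open import Data.List.Membership.Propositional using (_∈_)
open import Data.Product using (Σ; ∃; _×_; _,_)
open import Data.Sum using (_⊎_)
open import Data.Integer using (+_; ∣_∣)
open import Data.Rational using (ℚ; 0ℚ; _/_; _÷_; floor; _<_) renaming (_≤_ to _≤ℚ_)
open import Data.Rational.Base using (>-nonZero)
open import Relation.Nullary using (does; ¬_)
open import Relation.Binary.PropositionalEquality using (_≡_)

record Graph (n : ℕ) : Set where
  field
    adj    : Fin n → Fin n → Bool
    sym    : ∀ u v → adj u v ≡ adj v u
    irrefl : ∀ u → adj u u ≡ false
open Graph public

record Subgraph {n : ℕ} (G : Graph n) : Set where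
  field
    sadj : Fin n → Fin n → Bool
    ssym : ∀ u v → sadj u v ≡ sadj v u
    sub  : ∀ u v → sadj u v ≡ true → adj G u v ≡ true
open Subgraph public

countF : ∀ {n} → (Fin n → Bool) → ℕ
countF {zero}  P = 0
countF {suc n} P = (if P fzero then 1 else 0) + countF (λ i → P (fsuc i))

sumF : ∀ {n} → (Fin n → ℕ) → ℕ
sumF {zero}  g = 0
sumF {suc n} g = g fzero + sumF (λ i → g (fsuc i))

edgeCount : ∀ {n} → (Fin n → Fin n → Bool) → ℕ
edgeCount E = sumF (λ u → countF (λ v → (toℕ u <ᵇ toℕ v) ∧ E u v))

ℕtoℚ : ℕ → ℚ
ℕtoℚ m = (+ m) / 1

-- Walks and distances.  A Set-valued edge relation is used so that
-- graphs with faults removed can be described directly.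

data Walk {n : ℕ} (E : Fin n → Fin n → Set) : Fin n → Fin n → ℕ → Set where
  nil  : ∀ {u} → Walk E u u 0
  cons : ∀ {u v w k} → E u v → Walk E v w k → Walk E u w (suc k)

-- "d_X(s,t) ≤ d_Y(s,t) + β" with the usual convention d = ∞ when
-- t is unreachable: every s–t walk of length k in Y yields an
-- s–t walk of length ≤ k + β in X.
DistLe : ∀ {n} → (X Y : Fin n → Fin n → Set) → ℕ → Fin n → Fin n → Set
DistLe X Y β s t = ∀ k → Walk Y s t k → Σ ℕ (λ k' → k' ≤ k + β × Walk X s t k')

minusE : ∀ {n} → (Fin n → Fin n → Bool) → List (Fin n × Fin n) → Fin n → Fin n → Set
minusE X F u v = (X u v ≡ true) × ¬ ((u , v) ∈ F ⊎ (v , u) ∈ F)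

minusV : ∀ {n} → (Fin n → Fin n → Bool) → List (Fin n) → Fin n → Fin n → Set
minusV X F u v = (X u v ≡ true) × (¬ (u ∈ F) × ¬ (v ∈ F))

data FaultModel : Set where
  EFT VFT : FaultModel

SourcewiseSpanner : ∀ {n} → FaultModel → (G : Graph n) → Subgraph G →
                    (β f : ℕ) → (Fin n → Bool) → Set
SourcewiseSpanner {n} EFT G A β f S =
  ∀ (F : List (Fin n × Fin n)) → length F ≤ f →
  ∀ s t → S s ≡ true → DistLe (minusE (sadj A) F) (minusE (adj G) F) β s t
SourcewiseSpanner {n} VFT G A β f S =
  ∀ (F : List (Fin n)) → length F ≤ f →
  ∀ s t → S s ≡ true → DistLe (minusV (sadj A) F) (minusV (adj G) F) β s t

data Color : Set where
  white red black : Color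

isWhite : Color → Bool
isWhite white = true
isWhite red   = false
isWhite black = false

record State (n : ℕ) : Set where
  field
    color   : Fin n → Color
    counter : Fin n → ℕ
    inS     : Fin n → Bool
    E′      : Fin n → Fin n → Bool
open State public

initState : ∀ {n} → ℕ → State n
initState f = record
  { color   = λ _ → white
  ; counter = λ _ → suc f
  ; inS     = λ _ → false
  ; E′      = λ _ _ → false }

whiteNbrs : ∀ {n} → Graph n → State n → Fin n → ℕ
whiteNbrs G st s = countF (λ u → adj G s u ∧ isWhite (color st u))

step : ∀ {n} → Graph n → State n → Fin n → State n
step G st s = record
  { color   = λ u → if does (u ≟ᶠ s) then red
                    else if hit u then (if cnt u ≡ᵇ 0 then black else white)
                    else color st u
  ; counter = cnt
  ; inS     = λ u → inS st u ∨ does (u ≟ᶠ s)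
  ; E′      = λ u v → E′ st u v ∨ ((does (u ≟ᶠ s) ∧ hit v) ∨ (does (v ≟ᶠ s) ∧ hit u)) }
  where
    hit : _ → Bool
    hit u = adj G s u ∧ isWhite (color st u)
    cnt : _ → ℕ
    cnt u = if hit u then counter st u ∸ 1 else counter st u

Eligible : ∀ {n} → Graph n → ℚ → State n → Fin n → Set
Eligible G p st s = (inS st s ≡ false) × (p ≤ℚ ℕtoℚ (whiteNbrs G st s))

data Run {n : ℕ} (G : Graph n) (f : ℕ) (p : ℚ) : State n → Set where
  start : Run G f p (initState f)
  next  : ∀ {st} s → Run G f p st → Eligible G p st s → Run G f p (step G st s)

Terminated : ∀ {n} → Graph n → ℚ → State n → Set
Terminated G p st = ∀ s → ¬ Eligible G p st s

finalE′ : ∀ {n} → Graph n → State n → Fin n → Fin n → Bool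
finalE′ G st u v = E′ st u v ∨ (adj G u v ∧ (isWhite (color st u) ∨ isWhite (color st v)))

outputH : ∀ {n} → (G : Graph n) → State n → Subgraph G → Fin n → Fin n → Bool
outputH G st A u v = finalE′ G st u v ∨ sadj A u v

floorDiv : ℕ → (p : ℚ) → 0ℚ < p → ℕ
floorDiv m p pp = ∣ floor ((ℕtoℚ m ÷ p) {{>-nonZero pp}}) ∣

-- Every iteration of the loop picks a vertex s with w ≥ p white neighbours, decrements their
-- w counters and adds the w edges to E′. White vertices keep positive counters and the counters
-- start at (f+1)n in total, so at most (f+1)n decrements happen overall: hence |E′| ≤ (f+1)n and
-- |S|·p ≤ (f+1)n, i.e. |S| ≤ ⌊(f+1)n/p⌋, which bounds |E(A_S)| by γ(n, ⌊(f+1)n/p⌋) as γ is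
-- monotone. An edge with a white endpoint whose other endpoint is a source is already in E′;
-- every other one leaves a non-source towards a white vertex, and at termination each
-- non-source has fewer than p white neighbours, so the final step adds at most np edges.

module Submission where

open import Defs hiding (sym)
open import Data.Bool using (Bool; true; false; if_then_else_; _∧_; _∨_; not)
open import Data.Bool.Properties using (∨-identityʳ; ∨-zeroʳ; ∨-comm; ∧-conicalʳ; ∧-distribˡ-∨)
open import Data.Nat using (ℕ; zero; suc; _+_; _*_; _≤_; z≤n; s≤s; _<ᵇ_; >-nonZero)
import Data.Nat.Properties as ℕ
import Data.Nat.DivMod as ℕ
open import Data.Nat.Coprimality using (1-coprimeTo) renaming (sym to coprime-sym)
open import Data.Nat.Tactic.RingSolver using (solve-∀)
open import Algebra.Properties.CommutativeMonoid.Sum ℕ.+-0-commutativeMonoid using (sum; ∑-distrib-+; ∑-comm)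
open import Algebra.Properties.CommutativeSemigroup ℕ.+-commutativeSemigroup using (interchange)
open import Data.Integer as ℤ using (-[1+_]; ∣_∣)
import Data.Integer.Properties as ℤ
open import Data.Rational using (ℚ; mkℚ; ↥_; ↧ₙ_; 0ℚ; 1ℚ; _<_; floor; _÷_; positive; nonNegative; *≤*)
  renaming (_≤_ to _≤ℚ_; _+_ to _+ℚ_; _*_ to _*ℚ_)
import Data.Rational as ℚ using (>-nonZero)
import Data.Rational.Properties as ℚ
open import Data.Fin using (Fin; toℕ) renaming (zero to fzero; suc to fsuc)
open import Data.Fin.Properties using () renaming (_≟_ to _≟ᶠ_)
open import Data.Product using (∃; _,_)
open import Function using (_∘_)
open import Relation.Binary.PropositionalEquality
open import Relation.Nullary using (yes; no; does)

ind : Bool → ℕ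
ind b = if b then 1 else 0

sumF≡sum : ∀ {n} (g : Fin n → ℕ) → sumF g ≡ sum g
sumF≡sum {zero}  g = refl
sumF≡sum {suc n} g = cong (g fzero +_) (sumF≡sum (g ∘ fsuc))

sumF-cong : ∀ {n} {g h : Fin n → ℕ} → (∀ i → g i ≡ h i) → sumF g ≡ sumF h
sumF-cong {zero}  g≗h = refl
sumF-cong {suc n} g≗h = cong₂ _+_ (g≗h fzero) (sumF-cong (g≗h ∘ fsuc))

sumF-mono : ∀ {n} {g h : Fin n → ℕ} → (∀ i → g i ≤ h i) → sumF g ≤ sumF h
sumF-mono {zero}  g≤h = z≤n
sumF-mono {suc n} g≤h = ℕ.+-mono-≤ (g≤h fzero) (sumF-mono (g≤h ∘ fsuc))

sumF-+ : ∀ {n} (g h : Fin n → ℕ) → sumF (λ i → g i + h i) ≡ sumF g + sumF h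
sumF-+ g h = begin
  sumF (λ i → g i + h i)  ≡⟨ sumF≡sum (λ i → g i + h i) ⟩
  sum (λ i → g i + h i)   ≡⟨ ∑-distrib-+ g h ⟩
  sum g + sum h           ≡⟨ sym (cong₂ _+_ (sumF≡sum g) (sumF≡sum h)) ⟩
  sumF g + sumF h         ∎
  where open ≡-Reasoning

sumF-comm : ∀ {m n} (h : Fin m → Fin n → ℕ) →
            sumF (λ u → sumF (h u)) ≡ sumF (λ v → sumF (λ u → h u v))
sumF-comm h = begin
  sumF (λ u → sumF (h u))          ≡⟨ sumF≡sum² h ⟩
  sum (λ u → sum (h u))            ≡⟨ ∑-comm h ⟩
  sum (λ v → sum (λ u → h u v))    ≡⟨ sumF≡sum² (λ v u → h u v) ⟨
  sumF (λ v → sumF (λ u → h u v))  ∎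
  where
  open ≡-Reasoning
  sumF≡sum² : ∀ {m n} (k : Fin m → Fin n → ℕ) → sumF (λ u → sumF (k u)) ≡ sum (λ u → sum (k u))
  sumF≡sum² k = trans (sumF-cong (λ u → sumF≡sum (k u))) (sumF≡sum (λ u → sum (k u)))

sumF-zero : ∀ n → sumF {n} (λ _ → 0) ≡ 0
sumF-zero zero    = refl
sumF-zero (suc n) = sumF-zero n

sumF-const : ∀ n c → sumF {n} (λ _ → c) ≡ n * c
sumF-const zero    c = refl
sumF-const (suc n) c = cong (c +_) (sumF-const n c)

countF≡sumF : ∀ {n} (P : Fin n → Bool) → countF P ≡ sumF (ind ∘ P)
countF≡sumF {zero}  P = refl
countF≡sumF {suc n} P = cong (ind (P fzero) +_) (countF≡sumF (P ∘ fsuc))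

countF-cong : ∀ {n} {P Q : Fin n → Bool} → (∀ i → P i ≡ Q i) → countF P ≡ countF Q
countF-cong {P = P} {Q} P≗Q = trans (countF≡sumF P) (trans (sumF-cong (cong ind ∘ P≗Q)) (sym (countF≡sumF Q)))

ind-mono : ∀ {a b} → (a ≡ true → b ≡ true) → ind a ≤ ind b
ind-mono {false}         a⇒b = z≤n
ind-mono {true} {true}   a⇒b = ℕ.≤-refl
ind-mono {true} {false}  a⇒b with () ← a⇒b refl

countF-mono : ∀ {n} {P Q : Fin n → Bool} → (∀ i → P i ≡ true → Q i ≡ true) → countF P ≤ countF Q
countF-mono {zero}  P⇒Q = z≤n
countF-mono {suc n} P⇒Q = ℕ.+-mono-≤ (ind-mono (P⇒Q fzero)) (countF-mono (P⇒Q ∘ fsuc))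

ind-∨ : ∀ a b → ind (a ∨ b) ≤ ind a + ind b
ind-∨ false b = ℕ.≤-refl
ind-∨ true  b = s≤s z≤n

countF-∨ : ∀ {n} (P Q : Fin n → Bool) → countF (λ i → P i ∨ Q i) ≤ countF P + countF Q
countF-∨ P Q = begin
  countF (λ i → P i ∨ Q i)            ≡⟨ countF≡sumF (λ i → P i ∨ Q i) ⟩
  sumF (λ i → ind (P i ∨ Q i))        ≤⟨ sumF-mono (λ i → ind-∨ (P i) (Q i)) ⟩
  sumF (λ i → ind (P i) + ind (Q i))  ≡⟨ sumF-+ (ind ∘ P) (ind ∘ Q) ⟩
  sumF (ind ∘ P) + sumF (ind ∘ Q)     ≡⟨ cong₂ _+_ (countF≡sumF P) (countF≡sumF Q) ⟨
  countF P + countF Q                 ∎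
  where open ℕ.≤-Reasoning

countF-false : ∀ n → countF {n} (λ _ → false) ≡ 0
countF-false zero    = refl
countF-false (suc n) = countF-false n

countF-single : ∀ {n} (s : Fin n) b → countF (λ v → does (v ≟ᶠ s) ∧ b) ≡ ind b
countF-single {suc n} fzero    b = trans (cong (ind b +_) (countF-false n)) (ℕ.+-identityʳ (ind b))
countF-single {suc n} (fsuc s) b = countF-single s b

countF-insert : ∀ {n} (P : Fin n → Bool) s → P s ≡ false →
                countF (λ u → P u ∨ does (u ≟ᶠ s)) ≡ suc (countF P)
countF-insert {suc n} P fzero    Ps rewrite Ps = cong suc (countF-cong (λ i → ∨-identityʳ (P (fsuc i))))
countF-insert {suc n} P (fsuc s) Ps rewrite ∨-identityʳ (P fzero) =
  trans (cong (ind (P fzero) +_) (countF-insert (P ∘ fsuc) s Ps)) (ℕ.+-suc (ind (P fzero)) _)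

arcCount : ∀ {n} → (Fin n → Fin n → Bool) → ℕ
arcCount E = sumF (λ u → countF (E u))

arcCount-mono : ∀ {n} {E F : Fin n → Fin n → Bool} →
                (∀ u v → E u v ≡ true → F u v ≡ true) → arcCount E ≤ arcCount F
arcCount-mono E⇒F = sumF-mono (λ u → countF-mono (E⇒F u))

arcCount-∨ : ∀ {n} (E F : Fin n → Fin n → Bool) →
             arcCount (λ u v → E u v ∨ F u v) ≤ arcCount E + arcCount F
arcCount-∨ E F = ℕ.≤-trans (sumF-mono (λ u → countF-∨ (E u) (F u)))
                           (ℕ.≤-reflexive (sumF-+ (λ u → countF (E u)) (λ u → countF (F u))))

arcCount-transpose : ∀ {n} (E : Fin n → Fin n → Bool) → arcCount (λ u v → E v u) ≡ arcCount E
arcCount-transpose E = begin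
  sumF (λ u → countF (λ v → E v u))            ≡⟨ sumF-cong (λ u → countF≡sumF (λ v → E v u)) ⟩
  sumF (λ u → sumF (λ v → ind (E v u)))        ≡⟨ sumF-comm (λ u v → ind (E v u)) ⟩
  sumF (λ v → sumF (λ u → ind (E v u)))        ≡⟨ sumF-cong (λ v → countF≡sumF (E v)) ⟨
  sumF (λ v → countF (E v))                    ∎
  where open ≡-Reasoning

arcCount-into : ∀ {n} (s : Fin n) (P : Fin n → Bool) → arcCount (λ u v → does (v ≟ᶠ s) ∧ P u) ≡ countF P
arcCount-into s P = trans (sumF-cong (λ u → countF-single s (P u))) (sym (countF≡sumF P))

edgeCount≤arcCount : ∀ {n} (E : Fin n → Fin n → Bool) → edgeCount E ≤ arcCount E
edgeCount≤arcCount E = arcCount-mono (λ u v → ∧-conicalʳ (toℕ u <ᵇ toℕ v) (E u v))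

edgeCount-∨ : ∀ {n} (E F : Fin n → Fin n → Bool) →
              edgeCount (λ u v → E u v ∨ F u v) ≤ edgeCount E + edgeCount F
edgeCount-∨ {n} E F =
  ℕ.≤-trans (arcCount-mono distrib) (arcCount-∨ (λ u v → lt u v ∧ E u v) (λ u v → lt u v ∧ F u v))
  where
  lt : Fin n → Fin n → Bool
  lt u v = toℕ u <ᵇ toℕ v
  distrib : ∀ u v → lt u v ∧ (E u v ∨ F u v) ≡ true → (lt u v ∧ E u v) ∨ (lt u v ∧ F u v) ≡ true
  distrib u v = trans (sym (∧-distribˡ-∨ (lt u v) (E u v) (F u v)))

ℕtoℚ≡mkℚ : ∀ m → ℕtoℚ m ≡ mkℚ (ℤ.+ m) 0 (coprime-sym (1-coprimeTo m))
ℕtoℚ≡mkℚ m = ℚ.normalize-coprime {m} {0} (coprime-sym (1-coprimeTo m))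

ℕtoℚ-+ : ∀ a b → ℕtoℚ (a + b) ≡ ℕtoℚ a +ℚ ℕtoℚ b
ℕtoℚ-+ a b =
  trans (ℚ./-cong {ℤ.+ (a + b)} {1} numerator refl) (sym (cong₂ _+ℚ_ (ℕtoℚ≡mkℚ a) (ℕtoℚ≡mkℚ b)))
  where
  numerator : ℤ.+ (a + b) ≡ ℤ.+ a ℤ.* ℤ.1ℤ ℤ.+ ℤ.+ b ℤ.* ℤ.1ℤ
  numerator rewrite ℤ.*-identityʳ (ℤ.+ a) | ℤ.*-identityʳ (ℤ.+ b) = ℤ.pos-+ a b

ℕtoℚ-* : ∀ a b → ℕtoℚ (a * b) ≡ ℕtoℚ a *ℚ ℕtoℚ b
ℕtoℚ-* a b =
  trans (ℚ./-cong {ℤ.+ (a * b)} {1} (ℤ.pos-* a b) refl) (sym (cong₂ _*ℚ_ (ℕtoℚ≡mkℚ a) (ℕtoℚ≡mkℚ b)))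

ℕtoℚ-mono-≤ : ∀ {a b} → a ≤ b → ℕtoℚ a ≤ℚ ℕtoℚ b
ℕtoℚ-mono-≤ {a} {b} a≤b rewrite ℕtoℚ≡mkℚ a | ℕtoℚ≡mkℚ b =
  *≤* (subst₂ ℤ._≤_ (sym (ℤ.*-identityʳ (ℤ.+ a))) (sym (ℤ.*-identityʳ (ℤ.+ b))) (ℤ.+≤+ a≤b))

ℕtoℚ-suc-* : ∀ n q → ℕtoℚ (suc n) *ℚ q ≡ q +ℚ ℕtoℚ n *ℚ q
ℕtoℚ-suc-* n q = begin
  ℕtoℚ (1 + n) *ℚ q          ≡⟨ cong (_*ℚ q) (ℕtoℚ-+ 1 n) ⟩
  (1ℚ +ℚ ℕtoℚ n) *ℚ q         ≡⟨ ℚ.*-distribʳ-+ q 1ℚ (ℕtoℚ n) ⟩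
  1ℚ *ℚ q +ℚ ℕtoℚ n *ℚ q      ≡⟨ cong (_+ℚ ℕtoℚ n *ℚ q) (ℚ.*-identityˡ q) ⟩
  q +ℚ ℕtoℚ n *ℚ q            ∎
  where open ≡-Reasoning

ℕtoℚ-≤⇒ : ∀ m q → ℕtoℚ m ≤ℚ q → ℤ.+ (m * ↧ₙ q) ℤ.≤ ↥ q
ℕtoℚ-≤⇒ m q m≤q =
  subst₂ ℤ._≤_ (sym (ℤ.pos-* m (↧ₙ q))) (ℤ.*-identityʳ (↥ q)) (ℚ.drop-*≤* (subst (_≤ℚ q) (ℕtoℚ≡mkℚ m) m≤q))

≤∣floor∣ : ∀ m q → ℕtoℚ m ≤ℚ q → m ≤ ∣ floor q ∣
≤∣floor∣ m (mkℚ (ℤ.+ N) d coprime) m≤q = begin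
  m                                ≡⟨ ℕ.m*n/n≡m m (suc d) ⟨
  m * suc d ℕ./ suc d              ≤⟨ ℕ./-monoˡ-≤ (suc d) (ℤ.drop‿+≤+ (ℕtoℚ-≤⇒ m (mkℚ (ℤ.+ N) d coprime) m≤q)) ⟩
  N ℕ./ suc d                      ≡⟨ ℕ.*-identityˡ (N ℕ./ suc d) ⟨
  1 * (N ℕ./ suc d)                ≡⟨ ℤ.abs-* (ℤ.+ 1) (ℤ.+ (N ℕ./ suc d)) ⟨
  ∣ floor (mkℚ (ℤ.+ N) d coprime) ∣  ∎
  where open ℕ.≤-Reasoning
≤∣floor∣ m (mkℚ -[1+ k ] d _) m≤q with () ← ℕtoℚ-≤⇒ m (mkℚ -[1+ k ] d _) m≤q

≤floorDiv : ∀ k m p (p>0 : 0ℚ < p) → ℕtoℚ k *ℚ p ≤ℚ ℕtoℚ m → k ≤ floorDiv m p p>0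
≤floorDiv k m p p>0 kp≤m =
  ≤∣floor∣ k (ℕtoℚ m ÷ p) (ℚ.*-cancelʳ-≤-pos p (subst (ℕtoℚ k *ℚ p ≤ℚ_) (sym m÷p*p≡m) kp≤m))
  where
  instance
    _ = ℚ.>-nonZero p>0
    _ = positive p>0
  m÷p*p≡m : (ℕtoℚ m ÷ p) *ℚ p ≡ ℕtoℚ m
  m÷p*p≡m = trans (ℚ.*-assoc (ℕtoℚ m) _ p) (trans (cong (ℕtoℚ m *ℚ_) (ℚ.*-inverseˡ p)) (ℚ.*-identityʳ _))

sumF-≤ℚ : ∀ {n} (g : Fin n → ℕ) q → (∀ i → ℕtoℚ (g i) ≤ℚ q) → ℕtoℚ (sumF g) ≤ℚ ℕtoℚ n *ℚ q
sumF-≤ℚ {zero}  g q g≤q = ℚ.≤-reflexive (sym (ℚ.*-zeroˡ q))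
sumF-≤ℚ {suc n} g q g≤q = subst₂ _≤ℚ_ (sym (ℕtoℚ-+ (g fzero) _)) (sym (ℕtoℚ-suc-* n q))
  (ℚ.+-mono-≤ (g≤q fzero) (sumF-≤ℚ (g ∘ fsuc) q (g≤q ∘ fsuc)))

ℕtoℚ-*-≤ : ∀ k x y → ℕtoℚ x ≤ℚ y → ℕtoℚ (k * x) ≤ℚ ℕtoℚ k *ℚ y
ℕtoℚ-*-≤ k x y x≤y = subst (_≤ℚ ℕtoℚ k *ℚ y) (sym (ℕtoℚ-* k x)) (ℚ.*-monoˡ-≤-nonNeg (ℕtoℚ k) x≤y)
  where instance _ = nonNegative (ℕtoℚ-mono-≤ {0} {k} z≤n)

ℕtoℚ-+-monoˡ-≤ : ∀ x y {q} → ℕtoℚ x ≤ℚ q → ℕtoℚ (x + y) ≤ℚ q +ℚ ℕtoℚ y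
ℕtoℚ-+-monoˡ-≤ x y x≤q = subst (_≤ℚ _) (sym (ℕtoℚ-+ x y)) (ℚ.+-monoˡ-≤ (ℕtoℚ y) x≤q)

-- For an edge uv of finalE′: e = E′ u v, a = adj u v, and wu, wv (su, sv) say whether u, v are
-- white (in S).
white-endpoint-cases : ∀ (e a wu wv su sv : Bool) →
  (su ≡ true → wv ≡ true → a ≡ true → e ≡ true) →
  (sv ≡ true → wu ≡ true → a ≡ true → e ≡ true) →
  e ∨ (a ∧ (wu ∨ wv)) ≡ true → e ∨ ((not su ∧ (a ∧ wv)) ∨ (not sv ∧ (a ∧ wu))) ≡ true
white-endpoint-cases true  _     _     _     _     _     _  _  _ = refl
white-endpoint-cases false false _     _     _     _     _  _  ()
white-endpoint-cases false true  _     true  false _     _  _  _ = refl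
white-endpoint-cases false true  _     true  true  _     h₁ _  _ with () ← h₁ refl refl refl
white-endpoint-cases false true  true  false true  false _  _  _ = refl
white-endpoint-cases false true  true  false false false _  _  _ = refl
white-endpoint-cases false true  true  false _     true  _  h₂ _ with () ← h₂ refl refl refl
white-endpoint-cases false true  false false _     _     _  _  ()

module Loop {n} (G : Graph n) where

  whiteNbr : State n → Fin n → Fin n → Bool
  whiteNbr st s u = adj G s u ∧ isWhite (color st u)

  outsideToWhite : State n → Fin n → Fin n → Bool
  outsideToWhite st u v = not (inS st u) ∧ (adj G u v ∧ isWhite (color st v))

  WhiteCountersPositive : State n → Set
  WhiteCountersPositive st = ∀ u → isWhite (color st u) ≡ true → 1 ≤ counter st u

  step-white⇒white : ∀ st s u → isWhite (color (step G st s) u) ≡ true → isWhite (color st u) ≡ true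
  step-white⇒white st s u with u ≟ᶠ s | adj G s u | color st u
  ... | yes _ | _     | _     = λ ()
  ... | no _  | false | _     = λ white → white
  ... | no _  | true  | white = λ _ → refl
  ... | no _  | true  | red   = λ ()
  ... | no _  | true  | black = λ ()

  step-whiteCountersPositive : ∀ st s → WhiteCountersPositive st → WhiteCountersPositive (step G st s)
  step-whiteCountersPositive st s pos u with pos u
  ... | pos-u with u ≟ᶠ s | adj G s u | color st u | counter st u
  ...   | yes _ | _     | _     | _           = λ ()
  ...   | no _  | false | _     | _           = pos-u
  ...   | no _  | true  | white | zero        = λ ()
  ...   | no _  | true  | white | suc zero    = λ ()
  ...   | no _  | true  | white | suc (suc _) = λ _ → s≤s z≤n
  ...   | no _  | true  | red   | _           = pos-u
  ...   | no _  | true  | black | _           = pos-u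

  step-counter : ∀ st s → WhiteCountersPositive st → ∀ u →
                 counter (step G st s) u + ind (whiteNbr st s u) ≡ counter st u
  step-counter st s pos u with pos u
  ... | pos-u with adj G s u | color st u | counter st u
  ...   | false | _     | k     = ℕ.+-identityʳ k
  ...   | true  | white | zero  with () ← pos-u refl
  ...   | true  | white | suc k = ℕ.+-comm k 1
  ...   | true  | red   | k     = ℕ.+-identityʳ k
  ...   | true  | black | k     = ℕ.+-identityʳ k

  step-counters : ∀ st s → WhiteCountersPositive st →
                  sumF (counter (step G st s)) + whiteNbrs G st s ≡ sumF (counter st)
  step-counters st s pos = begin
    sumF c′ + countF (whiteNbr st s)                ≡⟨ cong (sumF c′ +_) (countF≡sumF (whiteNbr st s)) ⟩
    sumF c′ + sumF (ind ∘ whiteNbr st s)            ≡⟨ sumF-+ c′ (ind ∘ whiteNbr st s) ⟨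
    sumF (λ u → c′ u + ind (whiteNbr st s u))       ≡⟨ sumF-cong (step-counter st s pos) ⟩
    sumF (counter st)                               ∎
    where
    open ≡-Reasoning
    c′ : Fin n → ℕ
    c′ = counter (step G st s)

  step-arcs : ∀ st s → arcCount (E′ (step G st s)) ≤ arcCount (E′ st) + (whiteNbrs G st s + whiteNbrs G st s)
  step-arcs st s = begin
    arcCount (E′ (step G st s))
      ≤⟨ arcCount-∨ (E′ st) (λ u v → out u v ∨ in′ u v) ⟩
    arcCount (E′ st) + arcCount (λ u v → out u v ∨ in′ u v)
      ≤⟨ ℕ.+-monoʳ-≤ (arcCount (E′ st)) (arcCount-∨ out in′) ⟩
    arcCount (E′ st) + (arcCount out + arcCount in′)
      ≡⟨ cong (λ k → arcCount (E′ st) + (k + arcCount in′)) (arcCount-transpose in′) ⟩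
    arcCount (E′ st) + (arcCount in′ + arcCount in′)
      ≡⟨ cong (λ k → arcCount (E′ st) + (k + k)) (arcCount-into s (whiteNbr st s)) ⟩
    arcCount (E′ st) + (whiteNbrs G st s + whiteNbrs G st s)
      ∎
    where
    open ℕ.≤-Reasoning
    out in′ : Fin n → Fin n → Bool
    out u v = does (u ≟ᶠ s) ∧ whiteNbr st s v
    in′ u v = does (v ≟ᶠ s) ∧ whiteNbr st s u

  outsideToWhite-arcs≤ : ∀ {p} st → 0ℚ < p → Terminated G p st →
                         ℕtoℚ (arcCount (outsideToWhite st)) ≤ℚ ℕtoℚ n *ℚ p
  outsideToWhite-arcs≤ {p} st p>0 done = sumF-≤ℚ (countF ∘ outsideToWhite st) p bound
    where
    bound : ∀ u → ℕtoℚ (countF (outsideToWhite st u)) ≤ℚ p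
    bound u with inS st u in u∈S?
    ... | true  = subst (_≤ℚ p) (cong ℕtoℚ (sym (countF-false n))) (ℚ.<⇒≤ p>0)
    ... | false = ℚ.<⇒≤ (ℚ.≰⇒> λ p≤w → done u (u∈S? , p≤w))

  module _ {f : ℕ} {p : ℚ} where

    run⇒whiteCountersPositive : ∀ {st} → Run G f p st → WhiteCountersPositive st
    run⇒whiteCountersPositive start                 u _ = s≤s z≤n
    run⇒whiteCountersPositive (next {st} s run _) = step-whiteCountersPositive st s (run⇒whiteCountersPositive run)

    run⇒E′-sym : ∀ {st} → Run G f p st → ∀ u v → E′ st u v ≡ E′ st v u
    run⇒E′-sym start                 u v = refl
    run⇒E′-sym (next {st} s run _) u v =
      cong₂ _∨_ (run⇒E′-sym run u v) (∨-comm (does (u ≟ᶠ s) ∧ whiteNbr st s v) (does (v ≟ᶠ s) ∧ whiteNbr st s u))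

    run⇒source-edges : ∀ {st} → Run G f p st → ∀ s v → inS st s ≡ true → isWhite (color st v) ≡ true →
                       adj G s v ≡ true → E′ st s v ≡ true
    run⇒source-edges start s v ()
    run⇒source-edges (next {st} s₀ run _) s v s∈S v-white sv
      with step-white⇒white st s₀ v v-white | s ≟ᶠ s₀
    ... | v-white₀ | yes refl rewrite sv | v-white₀ = ∨-zeroʳ (E′ st s v)
    ... | v-white₀ | no _
      rewrite run⇒source-edges run s v (trans (sym (∨-identityʳ (inS st s))) s∈S) v-white₀ sv = refl

    finalE′⊆ : ∀ {st} → Run G f p st → ∀ u v → finalE′ G st u v ≡ true →
               E′ st u v ∨ (outsideToWhite st u v ∨ outsideToWhite st v u) ≡ true
    finalE′⊆ {st} run u v rewrite Graph.sym G v u =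
      white-endpoint-cases (E′ st u v) (adj G u v) (isWhite (color st u)) (isWhite (color st v)) (inS st u) (inS st v)
        (run⇒source-edges run u v)
        (λ v∈S u-white uv → trans (run⇒E′-sym run u v)
                                  (run⇒source-edges run v u v∈S u-white (trans (Graph.sym G v u) uv)))

    output-edges≤ : ∀ {st} → Run G f p st → (A : Subgraph G) →
      edgeCount (outputH G st A)
        ≤ arcCount (E′ st) + (arcCount (outsideToWhite st) + arcCount (outsideToWhite st)) + edgeCount (sadj A)
    output-edges≤ {st} run A = begin
      edgeCount (outputH G st A)
        ≤⟨ edgeCount-∨ (finalE′ G st) (sadj A) ⟩
      edgeCount (finalE′ G st) + a
        ≤⟨ ℕ.+-monoˡ-≤ a (edgeCount≤arcCount (finalE′ G st)) ⟩
      arcCount (finalE′ G st) + a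
        ≤⟨ ℕ.+-monoˡ-≤ a (arcCount-mono (finalE′⊆ run)) ⟩
      arcCount (λ u v → E′ st u v ∨ (T u v ∨ Tᵀ u v)) + a
        ≤⟨ ℕ.+-monoˡ-≤ a (arcCount-∨ (E′ st) (λ u v → T u v ∨ Tᵀ u v)) ⟩
      arcCount (E′ st) + arcCount (λ u v → T u v ∨ Tᵀ u v) + a
        ≤⟨ ℕ.+-monoˡ-≤ a (ℕ.+-monoʳ-≤ (arcCount (E′ st)) (arcCount-∨ T Tᵀ)) ⟩
      arcCount (E′ st) + (arcCount T + arcCount Tᵀ) + a
        ≡⟨ cong (λ k → arcCount (E′ st) + (arcCount T + k) + a) (arcCount-transpose T) ⟩
      arcCount (E′ st) + (arcCount T + arcCount T) + a
        ∎
      where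
      open ℕ.≤-Reasoning
      a : ℕ
      a = edgeCount (sadj A)
      T Tᵀ : Fin n → Fin n → Bool
      T = outsideToWhite st
      Tᵀ u v = T v u

    -- spent counts the counter decrements performed so far.
    record Budget (st : State n) : Set where
      field
        spent           : ℕ
        counters+spent  : sumF (counter st) + spent ≡ suc f * n
        sources*p≤spent : ℕtoℚ (countF (inS st)) *ℚ p ≤ℚ ℕtoℚ spent
        arcs≤2spent     : arcCount (E′ st) ≤ spent + spent

    initBudget : Budget (initState f)
    initBudget = record
      { spent           = 0
      ; counters+spent  = trans (ℕ.+-identityʳ _) (trans (sumF-const n (suc f)) (ℕ.*-comm n (suc f)))
      ; sources*p≤spent = ℚ.≤-reflexive (trans (cong (λ k → ℕtoℚ k *ℚ p) (countF-false n)) (ℚ.*-zeroˡ p))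
      ; arcs≤2spent     = ℕ.≤-reflexive (trans (sumF-cong {n} (λ _ → countF-false n)) (sumF-zero n))
      }

    stepBudget : ∀ st s → WhiteCountersPositive st → Eligible G p st s → Budget st → Budget (step G st s)
    stepBudget st s pos (s∉S , p≤w) b = record
      { spent           = w + spent
      ; counters+spent  = begin-equality
          sumF (counter (step G st s)) + (w + spent)  ≡⟨ ℕ.+-assoc _ w spent ⟨
          sumF (counter (step G st s)) + w + spent    ≡⟨ cong (_+ spent) (step-counters st s pos) ⟩
          sumF (counter st) + spent                   ≡⟨ counters+spent ⟩
          suc f * n                                   ∎
      ; sources*p≤spent = subst₂ _≤ℚ_
          (sym (trans (cong (λ k → ℕtoℚ k *ℚ p) (countF-insert (inS st) s s∉S))
                      (ℕtoℚ-suc-* (countF (inS st)) p)))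
          (sym (ℕtoℚ-+ w spent))
          (ℚ.+-mono-≤ p≤w sources*p≤spent)
      ; arcs≤2spent     = begin
          arcCount (E′ (step G st s))  ≤⟨ step-arcs st s ⟩
          arcCount (E′ st) + (w + w)   ≤⟨ ℕ.+-monoˡ-≤ (w + w) arcs≤2spent ⟩
          (spent + spent) + (w + w)    ≡⟨ interchange spent spent w w ⟩
          (spent + w) + (spent + w)    ≡⟨ cong₂ _+_ (ℕ.+-comm spent w) (ℕ.+-comm spent w) ⟩
          (w + spent) + (w + spent)    ∎
      }
      where
      open Budget b
      open ℕ.≤-Reasoning
      w : ℕ
      w = whiteNbrs G st s

    run⇒budget : ∀ {st} → Run G f p st → Budget st
    run⇒budget start                = initBudget
    run⇒budget (next {st} s run el) = stepBudget st s (run⇒whiteCountersPositive run) el (run⇒budget run)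

suc*n≤n*f+n*f : ∀ {f} n → 1 ≤ f → suc f * n ≤ n * f + n * f
suc*n≤n*f+n*f {f} n 1≤f = subst (n + f * n ≤_) (cong (n * f +_) (ℕ.*-comm f n))
  (ℕ.+-monoˡ-≤ (f * n) (ℕ.m≤m*n n f {{>-nonZero 1≤f}}))

four-term-bound : ∀ {e a} x m g → e ≤ (m + m) + (m + m) → a ≤ g → e + (x + x) + a ≤ 4 * (x + m + g)
four-term-bound {e} {a} x m g e≤ a≤g = begin
  e + (x + x) + a                                        ≤⟨ ℕ.+-mono-≤ (ℕ.+-monoˡ-≤ (x + x) e≤) a≤g ⟩
  (m + m) + (m + m) + (x + x) + g                        ≤⟨ ℕ.m≤m+n _ (x + x + g + g + g) ⟩
  (m + m) + (m + m) + (x + x) + g + (x + x + g + g + g)  ≡⟨ rearrange x m g ⟩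
  4 * (x + m + g)                                        ∎
  where
  open ℕ.≤-Reasoning
  rearrange : ∀ x m g → (m + m) + (m + m) + (x + x) + g + (x + x + g + g + g) ≡ 4 * (x + m + g)
  rearrange = solve-∀

output-size≤ : ∀ {n} (G : Graph n) {f} → 1 ≤ f → ∀ {p} (p>0 : 0ℚ < p) {γ : ℕ → ℕ → ℕ} →
  (∀ m l l′ → l ≤ l′ → γ m l ≤ γ m l′) →
  ∀ {st} → Run G f p st → Terminated G p st → (A : Subgraph G) →
  edgeCount (sadj A) ≤ γ n (countF (inS st)) →
  ℕtoℚ (edgeCount (outputH G st A))
    ≤ℚ ℕtoℚ 4 *ℚ (ℕtoℚ n *ℚ p +ℚ ℕtoℚ (n * f) +ℚ ℕtoℚ (γ n (floorDiv (suc f * n) p p>0)))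
output-size≤ {n} G {f} 1≤f {p} p>0 {γ} γ-mono {st} run done A A≤γ =
  ℚ.≤-trans (ℕtoℚ-mono-≤ edges≤) (ℕtoℚ-*-≤ 4 (X + n * f + g) _
    (ℕtoℚ-+-monoˡ-≤ (X + n * f) g (ℕtoℚ-+-monoˡ-≤ X (n * f) (outsideToWhite-arcs≤ st p>0 done))))
  where
  open Loop G
  open Budget (run⇒budget run)
  X g : ℕ
  X = arcCount (outsideToWhite st)
  g = γ n (floorDiv (suc f * n) p p>0)
  spent≤total : spent ≤ suc f * n
  spent≤total = subst (spent ≤_) counters+spent (ℕ.m≤n+m spent (sumF (counter st)))
  sources≤ : countF (inS st) ≤ floorDiv (suc f * n) p p>0
  sources≤ = ≤floorDiv (countF (inS st)) (suc f * n) p p>0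
               (ℚ.≤-trans sources*p≤spent (ℕtoℚ-mono-≤ spent≤total))
  arcs≤ : arcCount (E′ st) ≤ (n * f + n * f) + (n * f + n * f)
  arcs≤ = ℕ.≤-trans arcs≤2spent (ℕ.+-mono-≤ spent≤ spent≤)
    where
    spent≤ : spent ≤ n * f + n * f
    spent≤ = ℕ.≤-trans spent≤total (suc*n≤n*f+n*f n 1≤f)
  edges≤ : edgeCount (outputH G st A) ≤ 4 * (X + n * f + g)
  edges≤ = ℕ.≤-trans (output-edges≤ run A)
             (four-term-bound X (n * f) g arcs≤ (ℕ.≤-trans A≤γ (γ-mono n _ _ sources≤)))

lemma1 : ∃ λ (c : ℕ) →
    ∀ (mode : FaultModel) (n : ℕ) (G : Graph n) (f : ℕ) → 1 ≤ f →
    (p : ℚ) (pp : 0ℚ < p) →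
    (γ : ℕ → ℕ → ℕ) → (∀ m l l′ → l ≤ l′ → γ m l ≤ γ m l′) →
    (β : ℕ) (st : State n) → Run G f p st → Terminated G p st →
    (A : Subgraph G) → SourcewiseSpanner mode G A β f (inS st) →
    edgeCount (sadj A) ≤ γ n (countF (inS st)) →
    ℕtoℚ (edgeCount (outputH G st A))
      ≤ℚ ℕtoℚ c *ℚ (ℕtoℚ n *ℚ p +ℚ ℕtoℚ (n * f)
                     +ℚ ℕtoℚ (γ n (floorDiv (suc f * n) p pp)))
-- Only the size of A_S enters the bound.
lemma1 = 4 , λ _ _ G _ 1≤f _ p>0 _ γ-mono _ _ run done A _ A≤γ → output-size≤ G 1≤f p>0 γ-mono run done A A≤γ
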